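{- Let $k\ge2$ and $n>2^k$ be integers, $c=2^k-2$, and assume $d:=\gcd(c,n-1)>1$. Let $w=(n-1)/d$ and define $y\in\mathbb R^V$ on $V=\{0,\dots,n-1\}$ by $y_v=0$ if $v$ is a multiple of $d$ (i.e., $v=jd$ for some integer $j\ge0$) and $y_v=\frac{1}{w(d-1)}$ otherwise. Then $y$ is a probability distribution on $V$ and $\max_{T\in\mathcal T_k} y(C(T))=\frac{c}{n-1}$ (so $y$ is a feasible hider strategy with objective value $\frac{c}{n-1}$). Hence, if $x$ is the output of the greedy algorithm described in the context, the pair $(x,y)$ is a Nash equilibrium of the unit-profit search game.
   Context: Let $G$ be the path with vertex set $V=\{0,\dots,n-1\}$ and edges $\{v,v+1\}$, $0\le v\le n-2$. A search strategy for a tree $H$ is a rooted binary tree whose internal nodes are labeled by edges of $H$, defined recursively: a single node is a search strategy for any tree; otherwise the root is labeled by an edge $uv$ and its two subtrees are search strategies for the components of $H-uv$ containing $u$ and $v$. Nodes carry vertex sets: root gets $V(H)$, subtree roots recursively get the vertex sets of those components. $C(T)$, the covered set, is the set of $v$ with $\{v\}$ equal to some leaf's vertex set. $\mathcal T_k$ is the set of search strategies for $G$ of height at most $k$. For $S\subseteq V$, $y(S)=\sum_{v\in S}y_v$. In the unit-profit game, the seeker picks a distribution $x$ on $\mathcal T_k$, the hider a distribution $y$ on $V$, and the seeker's payoff (hider's cost) is $\sum_T\sum_v x_Ty_v\mathbf 1[v\in C(T)]$; a Nash equilibrium is a pair from which no player can unilaterally improve. Interval notation: $[u,v]_r=\{z\bmod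 r:u\le z\le v\}$ if $u\le v$, else $\emptyset$; $[v\oplus\ell]=[v,v+\ell-1]_n$. For $v\in V\setminus\{1\}$, $T_v\in\mathcal T_k$ is a strategy with $C(T_v)=[v\oplus(c+1)]$ if $\{0,n-1\}\cap[v\oplus(c+1)]\ne\emptyset$, else $C(T_v)=[v\oplus c]$. Greedy algorithm: set $v=c+1$, $\mathcal X=\{T_0\}$; while $v\notin\{0,1\}$, add $T_v$ to $\mathcal X$ and set $v:=(v+c)\bmod(n-1)$; output $x_T=1/|\mathcal X|$ for $T\in\mathcal X$, else $0$. -}

module Defs where

open import Data.Nat as ℕ using (ℕ; zero; suc; _∸_; _≤ᵇ_; _≡ᵇ_; _^_; _%_)
open import Data.Nat.GCD using (gcd)
open import Data.Nat.Divisibility using (_∣?_)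
open import Data.Integer using (+_)
open import Data.Rational as ℚ using (ℚ; 0ℚ; 1ℚ)
open import Data.Bool using (Bool; true; false; if_then_else_; _∧_; _∨_)
open import Data.List using (List; []; _∷_; map; sum; upTo; length; foldr)
open import Data.List.Relation.Unary.All using (All)
open import Data.Product using (Σ; _×_; _,_; proj₁; proj₂)
open import Data.Sum using (_⊎_)
open import Relation.Nullary using (does; ¬_)
open import Relation.Binary.PropositionalEquality using (_≡_)

-- Every component arising by deleting edges of a path is a subpath
-- (interval) [a,b]; a search strategy for the interval [a,b] is either
-- a single node, or a root labelled by an edge {e,e+1} (a ≤ e < b) with
-- subtrees = strategies for the components [a,e] and [e+1,b].

data Strat : ℕ → ℕ → Set where
  leaf : ∀ {a b} → Strat a b
  node : ∀ {a b} (e : ℕ) → a ℕ.≤ e → e ℕ.< b →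
         Strat a e → Strat (suc e) b → Strat a b

height : ∀ {a b} → Strat a b → ℕ
height leaf = 0
height (node _ _ _ l r) = suc (ℕ._⊔_ (height l) (height r))

-- v ∈ C(T): some leaf's vertex set [a,b] equals {v}, i.e. a = b = v.
covered : ∀ {a b} → Strat a b → ℕ → Bool
covered {a} {b} leaf v = (a ≡ᵇ b) ∧ (a ≡ᵇ v)
covered (node _ _ _ l r) v = covered l v ∨ covered r v

StratG : ℕ → Set
StratG n = Strat 0 (n ∸ 1)

-- a / b as a rational (only used with b ≠ 0; value 0 when b = 0)
fracℕ : ℕ → ℕ → ℚ
fracℕ a zero = 0ℚ
fracℕ a (suc m) = (+ a) ℚ./ suc m

modℕ : ℕ → ℕ → ℕ
modℕ a zero = a
modℕ a (suc m) = a % suc m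

sumℚ : List ℚ → ℚ
sumℚ = foldr ℚ._+_ 0ℚ

sumV : ℕ → (ℕ → ℚ) → ℚ
sumV n y = sumℚ (map y (upTo n))

yC : (n : ℕ) → (ℕ → ℚ) → StratG n → ℚ
yC n y T = sumℚ (map (λ v → if covered T v then y v else 0ℚ) (upTo n))

IsHiderDist : ℕ → (ℕ → ℚ) → Set
IsHiderDist n y = (∀ v → v ℕ.< n → 0ℚ ℚ.≤ y v) × (sumV n y ≡ 1ℚ)

SeekerMixed : ℕ → Set
SeekerMixed n = List (StratG n × ℚ)

IsSeekerDist : (n k : ℕ) → SeekerMixed n → Set
IsSeekerDist n k xs =
  All (λ p → (height (proj₁ p) ℕ.≤ k) × (0ℚ ℚ.≤ proj₂ p)) xs
  × (sumℚ (map proj₂ xs) ≡ 1ℚ)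

payoff : (n : ℕ) → SeekerMixed n → (ℕ → ℚ) → ℚ
payoff n xs y = sumℚ (map (λ p → proj₂ p ℚ.* yC n y (proj₁ p)) xs)

IsNash : (n k : ℕ) → SeekerMixed n → (ℕ → ℚ) → Set
IsNash n k x y =
  IsSeekerDist n k x × IsHiderDist n y
  × (∀ x′ → IsSeekerDist n k x′ → payoff n x′ y ℚ.≤ payoff n x y)
  × (∀ y′ → IsHiderDist n y′ → payoff n x y ℚ.≤ payoff n x y′)

InInterval : (n v ℓ z : ℕ) → Set
InInterval n v ℓ z = Σ ℕ λ i → (i ℕ.< ℓ) × (z ≡ modℕ (v ℕ.+ i) n)

IsTv : (n k c v : ℕ) → StratG n → Set
IsTv n k c v T =
  (height T ℕ.≤ k) ×
  (((InInterval n v (suc c) 0 ⊎ InInterval n v (suc c) (n ∸ 1)) →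
      ∀ z → (covered T z ≡ true → InInterval n v (suc c) z)
          × (InInterval n v (suc c) z → covered T z ≡ true))
  × ((¬ (InInterval n v (suc c) 0 ⊎ InInterval n v (suc c) (n ∸ 1))) →
      ∀ z → (covered T z ≡ true → InInterval n v c z)
          × (InInterval n v c z → covered T z ≡ true)))

-- The loop is run with fuel n (it terminates
-- after fewer than n iterations under the theorem's hypotheses).

greedyLoop : (n : ℕ) → (c : ℕ) → (ℕ → StratG n) → ℕ → ℕ → List (StratG n)
greedyLoop n c T zero v = []
greedyLoop n c T (suc f) v =
  if v ≤ᵇ 1 then [] else T v ∷ greedyLoop n c T f (modℕ (v ℕ.+ c) (n ∸ 1))

greedySet : (n : ℕ) → (c : ℕ) → (ℕ → StratG n) → List (StratG n)
greedySet n c T = T 0 ∷ greedyLoop n c T n (suc c)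

greedyX : (n : ℕ) → (c : ℕ) → (ℕ → StratG n) → SeekerMixed n
greedyX n c T =
  map (λ S → S , fracℕ 1 (length (greedySet n c T))) (greedySet n c T)

cOf : ℕ → ℕ
cOf k = 2 ^ k ∸ 2

dOf : ℕ → ℕ → ℕ
dOf n k = gcd (cOf k) (n ∸ 1)

-- a / b on ℕ (only used with b ≠ 0, and here b ∣ a)
divℕ : ℕ → ℕ → ℕ
divℕ a zero = 0
divℕ a (suc m) = a ℕ./ suc m

wOf : ℕ → ℕ → ℕ
wOf n k = divℕ (n ∸ 1) (dOf n k)

yStar : ℕ → ℕ → ℕ → ℚ
yStar n k v =
  if does (dOf n k ∣? v) then 0ℚ
  else fracℕ 1 (wOf n k ℕ.* (dOf n k ∸ 1))

-- A strategy of height at most k has at most 2^k = c + 2 leaves, and its covered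
-- vertices are its singleton leaves.  Cut V into {0} and the blocks jd+1, …, (j+1)d.  Every block
-- containing a covered non-multiple of d also contains the left end of a leaf that is not a
-- covered non-multiple (the run of covered vertices has to stop by the multiple (j+1)d), and so
-- does {0}; a block holds only d - 1 non-multiples.  Counting left ends of leaves, at most
-- (d - 1)c/d non-multiples are covered, i.e. y(C(T)) ≤ c/(n-1), and a strategy covering exactly
-- {0, …, c} attains this.  The greedy vertices 1 + jc mod (n-1), j < w, start windows of c consecutive
-- points of the cycle ℤ/(n-1); going once around the orbit, the windows wind c/d times around the
-- cycle, so every point lies in c/d of the w windows, and T_v covers its window.  Hence each
-- vertex is found with probability at least c/(n-1) against the uniform greedy mixture, and the
-- two bounds meet.

module Submission where

open import Defs
open import Data.Nat using (ℕ; _≤_; _<_; _^_; _∸_)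
open import Data.Rational using (ℚ) renaming (_≤_ to _≤ℚ_)
open import Data.Product using (Σ; _×_)
open import Relation.Binary.PropositionalEquality using (_≡_; _≢_)

open import Algebra.Bundles using (CommutativeMonoid)
open import Data.Bool using (Bool; true; false; T; not; _∧_; _∨_; if_then_else_)
import Data.Bool.Properties as BoolP
open import Data.Empty using (⊥-elim)
open import Data.Integer as ℤ using () renaming (+_ to ⁺_)
import Data.Integer.Properties as ℤP
import Data.Integer.Tactic.RingSolver as ℤSolver
open import Data.List using (List; []; _∷_; map; length; applyUpTo; upTo)
import Data.List.Properties as LP
open import Data.List.Relation.Unary.All as All using (All; []; _∷_)
open import Data.List.Relation.Unary.All.Properties using (applyUpTo⁺₁; map⁺)
open import Data.Nat as ℕ using (zero; suc; _+_; _*_; _%_; _/_; _≡ᵇ_; _≤ᵇ_; _<ᵇ_; z≤n; s≤s; NonZero)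
open import Data.Nat.DivMod
  using (m≡m%n+[m/n]*n; m*n/n≡m; m<n⇒m%n≡m; m%n<n; m%n%n≡m%n; [m+n]%n≡m%n; [m+kn]%n≡m%n; %-distribˡ-+)
open import Data.Nat.Divisibility
  using (_∣_; _∣?_; divides; ∣-trans; n∣m*n; ∣m+n∣m⇒∣n; ∣⇒≤; ∣1⇒≡1; m%n≡0⇒n∣m)
open import Data.Nat.GCD using (gcd[m,n]∣m; gcd[m,n]∣n)
import Data.Nat.Properties as ℕP
import Data.Nat.Tactic.RingSolver as ℕSolver
open import Data.Product using (_,_; proj₁; proj₂)
open import Data.Rational as ℚ using (0ℚ; 1ℚ; fromℚᵘ)
import Data.Rational.Properties as ℚP
open import Data.Rational.Unnormalised as ℚᵘ using (mkℚᵘ; *≡*; *≤*)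
import Data.Rational.Unnormalised.Properties as ℚᵘP
open import Data.Sum using (_⊎_; inj₁; inj₂)
open import Function using (_∘_; id)
open import Relation.Binary.PropositionalEquality
open import Relation.Nullary using (¬_; yes; no; does)
open import Relation.Nullary.Decidable using (dec-true; dec-false)

open import Algebra.Properties.CommutativeSemigroup ℕP.+-commutativeSemigroup
  using () renaming (interchange to +-interchange)
open import Algebra.Properties.CommutativeSemigroup (CommutativeMonoid.commutativeSemigroup ℚP.+-0-commutativeMonoid)
  using () renaming (interchange to ℚ-+-interchange)

≡ᵇ-true⇒≡ : ∀ {m n} → (m ≡ᵇ n) ≡ true → m ≡ n
≡ᵇ-true⇒≡ {m} {n} eq = ℕP.≡ᵇ⇒≡ m n (subst T (sym eq) _)

≡ᵇ-refl : ∀ n → (n ≡ᵇ n) ≡ true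
≡ᵇ-refl zero    = refl
≡ᵇ-refl (suc n) = ≡ᵇ-refl n

≢⇒≡ᵇ-false : ∀ {m n} → m ≢ n → (m ≡ᵇ n) ≡ false
≢⇒≡ᵇ-false m≢n = BoolP.¬-not (λ eq → m≢n (≡ᵇ-true⇒≡ eq))

≤ᵇ-true⇒≤ : ∀ {m n} → (m ≤ᵇ n) ≡ true → m ≤ n
≤ᵇ-true⇒≤ {m} {n} eq = ℕP.≤ᵇ⇒≤ m n (subst T (sym eq) _)

≤ᵇ-false⇒> : ∀ {m n} → (m ≤ᵇ n) ≡ false → n < m
≤ᵇ-false⇒> {m} {n} eq = ℕP.≰⇒> (λ m≤n → subst T eq (ℕP.≤⇒≤ᵇ m≤n))

<⇒<ᵇ-true : ∀ {m n} → m < n → (m <ᵇ n) ≡ true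
<⇒<ᵇ-true {m} {n} m<n with m <ᵇ n | ℕP.<⇒<ᵇ m<n
... | true | _ = refl

<ᵇ-true⇒< : ∀ {m n} → (m <ᵇ n) ≡ true → m < n
<ᵇ-true⇒< {m} {n} eq = ℕP.<ᵇ⇒< m n (subst T (sym eq) _)

≥⇒<ᵇ-false : ∀ {m n} → n ≤ m → (m <ᵇ n) ≡ false
≥⇒<ᵇ-false {m} {n} n≤m with m <ᵇ n in eq
... | false = refl
... | true  = ⊥-elim (ℕP.<⇒≱ (<ᵇ-true⇒< {m} eq) n≤m)

≤ᵇ1∧≢0⇒≡1 : ∀ {m} → (m ≤ᵇ 1) ≡ true → m ≢ 0 → m ≡ 1
≤ᵇ1∧≢0⇒≡1 {zero}        _ m≢0 = ⊥-elim (m≢0 refl)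
≤ᵇ1∧≢0⇒≡1 {suc zero}    _ _   = refl
≤ᵇ1∧≢0⇒≡1 {suc (suc m)} () _

fromℚᵘ-+ : ∀ p q → fromℚᵘ (p ℚᵘ.+ q) ≡ fromℚᵘ p ℚ.+ fromℚᵘ q
fromℚᵘ-+ p q = ℚP.toℚᵘ-injective (begin-equality
  ℚ.toℚᵘ (fromℚᵘ (p ℚᵘ.+ q))                  ≃⟨ ℚP.toℚᵘ-fromℚᵘ _ ⟩
  p ℚᵘ.+ q                                     ≃⟨ ℚᵘP.+-cong (ℚP.toℚᵘ-fromℚᵘ p) (ℚP.toℚᵘ-fromℚᵘ q) ⟨
  ℚ.toℚᵘ (fromℚᵘ p) ℚᵘ.+ ℚ.toℚᵘ (fromℚᵘ q)     ≃⟨ ℚP.toℚᵘ-homo-+ (fromℚᵘ p) (fromℚᵘ q) ⟨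
  ℚ.toℚᵘ (fromℚᵘ p ℚ.+ fromℚᵘ q)               ∎)
  where open ℚᵘP.≤-Reasoning

fromℚᵘ-mono-≤ : ∀ {p q} → p ℚᵘ.≤ q → fromℚᵘ p ℚ.≤ fromℚᵘ q
fromℚᵘ-mono-≤ {p} {q} p≤q = ℚP.toℚᵘ-cancel-≤
  (ℚᵘP.≤-respˡ-≃ (ℚᵘP.≃-sym (ℚP.toℚᵘ-fromℚᵘ p)) (ℚᵘP.≤-respʳ-≃ (ℚᵘP.≃-sym (ℚP.toℚᵘ-fromℚᵘ q)) p≤q))

fracℕ-≡ : ∀ a b {M K} → 0 < M → 0 < K → a * K ≡ b * M → fracℕ a M ≡ fracℕ b K
fracℕ-≡ a b {suc m} {suc k} _ _ eq = ℚP.fromℚᵘ-cong {mkℚᵘ (⁺ a) m} {mkℚᵘ (⁺ b) k} (*≡* (begin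
  ⁺ a ℤ.* ⁺ suc k  ≡⟨ ℤP.pos-* a (suc k) ⟨
  ⁺ (a * suc k)    ≡⟨ cong ⁺_ eq ⟩
  ⁺ (b * suc m)    ≡⟨ ℤP.pos-* b (suc m) ⟩
  ⁺ b ℤ.* ⁺ suc m  ∎))
  where open ≡-Reasoning

fracℕ-≤ : ∀ a b {M K} → 0 < M → 0 < K → a * K ≤ b * M → fracℕ a M ℚ.≤ fracℕ b K
fracℕ-≤ a b {suc m} {suc k} _ _ le = fromℚᵘ-mono-≤ {mkℚᵘ (⁺ a) m} {mkℚᵘ (⁺ b) k} (*≤* (subst₂ ℤ._≤_
  (ℤP.pos-* a (suc k)) (ℤP.pos-* b (suc m)) (ℤ.+≤+ le)))

fracℕ-+ : ∀ a b {M} → 0 < M → fracℕ a M ℚ.+ fracℕ b M ≡ fracℕ (a + b) M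
fracℕ-+ a b {suc m} _ = begin
  fromℚᵘ (mkℚᵘ (⁺ a) m) ℚ.+ fromℚᵘ (mkℚᵘ (⁺ b) m)  ≡⟨ fromℚᵘ-+ (mkℚᵘ (⁺ a) m) (mkℚᵘ (⁺ b) m) ⟨
  fromℚᵘ (mkℚᵘ (⁺ a) m ℚᵘ.+ mkℚᵘ (⁺ b) m)
    ≡⟨ ℚP.fromℚᵘ-cong {mkℚᵘ (⁺ a) m ℚᵘ.+ mkℚᵘ (⁺ b) m} {mkℚᵘ (⁺ (a + b)) m} (*≡* cross) ⟩
  fromℚᵘ (mkℚᵘ (⁺ (a + b)) m)                     ∎
  where
  open ≡-Reasoning
  M = ⁺ suc m
  distrib : ∀ x y z → (x ℤ.* z ℤ.+ y ℤ.* z) ℤ.* z ≡ (x ℤ.+ y) ℤ.* (z ℤ.* z)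
  distrib = ℤSolver.solve-∀
  cross : (⁺ a ℤ.* M ℤ.+ ⁺ b ℤ.* M) ℤ.* M ≡ ⁺ (a + b) ℤ.* (M ℤ.* M)
  cross = trans (distrib (⁺ a) (⁺ b) M) (cong (ℤ._* (M ℤ.* M)) (ℤP.pos-+ a b))

fracℕ-0 : ∀ M → fracℕ 0 M ≡ 0ℚ
fracℕ-0 zero    = refl
fracℕ-0 (suc m) = ℚP.0/n≡0 (suc m)

fracℕ-nonNeg : ∀ a M → 0ℚ ℚ.≤ fracℕ a M
fracℕ-nonNeg a zero    = ℚP.≤-refl
fracℕ-nonNeg a (suc m) = ℚP.nonNegative⁻¹ _ {{ℚP.normalize-nonNeg a (suc m)}}

fracℕ-self : ∀ {M} → 0 < M → fracℕ M M ≡ 1ℚ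
fracℕ-self {M} M>0 = fracℕ-≡ M 1 {M} {1} M>0 (s≤s z≤n) (ℕP.*-comm M 1)

𝟙 : Bool → ℕ
𝟙 true  = 1
𝟙 false = 0

𝟙≤1 : ∀ b → 𝟙 b ≤ 1
𝟙≤1 true  = s≤s z≤n
𝟙≤1 false = z≤n

𝟙-mono : ∀ {a b} → (a ≡ true → b ≡ true) → 𝟙 a ≤ 𝟙 b
𝟙-mono {false} _   = z≤n
𝟙-mono {true}  a⇒b rewrite a⇒b refl = s≤s z≤n

count : ∀ {A : Set} → (A → Bool) → List A → ℕ
count B []       = 0
count B (x ∷ xs) = 𝟙 (B x) + count B xs

count-map-mono : ∀ {A C : Set} (B : A → Bool) (B′ : C → Bool) (g : A → C) {xs} →
  All (λ x → B x ≡ true → B′ (g x) ≡ true) xs → count B xs ≤ count B′ (map g xs)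
count-map-mono B B′ g []         = z≤n
count-map-mono B B′ g (h ∷ hs) = ℕP.+-mono-≤ (𝟙-mono h) (count-map-mono B B′ g hs)

sum< : ℕ → (ℕ → ℕ) → ℕ
sum< zero    f = 0
sum< (suc l) f = f 0 + sum< l (f ∘ suc)

syntax sum< l (λ i → e) = ∑[ i < l ] e

count-applyUpTo : ∀ (B : ℕ → Bool) f l → count B (applyUpTo f l) ≡ ∑[ i < l ] 𝟙 (B (f i))
count-applyUpTo B f zero    = refl
count-applyUpTo B f (suc l) = cong (𝟙 (B (f 0)) +_) (count-applyUpTo B (f ∘ suc) l)

∑-mono : ∀ l {f g} → (∀ i → i < l → f i ≤ g i) → sum< l f ≤ sum< l g
∑-mono zero    f≤g = z≤n
∑-mono (suc l) f≤g = ℕP.+-mono-≤ (f≤g 0 (s≤s z≤n)) (∑-mono l (λ i i<l → f≤g (suc i) (s≤s i<l)))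

∑-cong : ∀ l {f g} → (∀ i → i < l → f i ≡ g i) → sum< l f ≡ sum< l g
∑-cong l f≡g = ℕP.≤-antisym (∑-mono l (λ i i<l → ℕP.≤-reflexive (f≡g i i<l)))
                             (∑-mono l (λ i i<l → ℕP.≤-reflexive (sym (f≡g i i<l))))

∑-+ : ∀ l f g → ∑[ i < l ] (f i + g i) ≡ sum< l f + sum< l g
∑-+ zero    f g = refl
∑-+ (suc l) f g = trans (cong (f 0 + g 0 +_) (∑-+ l (f ∘ suc) (g ∘ suc)))
                        (+-interchange (f 0) (g 0) (sum< l (f ∘ suc)) (sum< l (g ∘ suc)))

∑-*ˡ : ∀ a l f → ∑[ i < l ] (a * f i) ≡ a * sum< l f
∑-*ˡ a zero    f = sym (ℕP.*-zeroʳ a)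
∑-*ˡ a (suc l) f = trans (cong (a * f 0 +_) (∑-*ˡ a l (f ∘ suc))) (sym (ℕP.*-distribˡ-+ a (f 0) _))

∑-const : ∀ l a → ∑[ i < l ] a ≡ l * a
∑-const zero    a = refl
∑-const (suc l) a = cong (a +_) (∑-const l a)

∑-zero : ∀ l {f} → (∀ i → i < l → f i ≡ 0) → sum< l f ≡ 0
∑-zero l f≡0 = trans (∑-cong l f≡0) (trans (∑-const l 0) (ℕP.*-zeroʳ l))

∑-split : ∀ l₁ l₂ f → sum< (l₁ + l₂) f ≡ sum< l₁ f + ∑[ i < l₂ ] f (l₁ + i)
∑-split zero     l₂ f = refl
∑-split (suc l₁) l₂ f = trans (cong (f 0 +_) (∑-split l₁ l₂ (f ∘ suc))) (sym (ℕP.+-assoc (f 0) _ _))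

∑-blocks : ∀ w d f → ∑[ v < w * d ] f v ≡ ∑[ j < w ] ∑[ i < d ] f (j * d + i)
∑-blocks zero    d f = refl
∑-blocks (suc w) d f = begin
  sum< (d + w * d) f                                            ≡⟨ ∑-split d (w * d) f ⟩
  sum< d f + ∑[ v < w * d ] f (d + v)                   ≡⟨ cong (sum< d f +_) (∑-blocks w d (λ v → f (d + v))) ⟩
  sum< d f + ∑[ j < w ] ∑[ i < d ] f (d + (j * d + i))
    ≡⟨ cong (sum< d f +_) (∑-cong w (λ j _ → ∑-cong d (λ i _ → cong f (sym (ℕP.+-assoc d (j * d) i))))) ⟩
  sum< d f + ∑[ j < w ] ∑[ i < d ] f (suc j * d + i)    ∎
  where open ≡-Reasoning

term≤∑ : ∀ l f {i} → i < l → f i ≤ sum< l f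
term≤∑ (suc l) f {zero}  _         = ℕP.m≤m+n (f 0) _
term≤∑ (suc l) f {suc i} (s≤s i<l) = ℕP.≤-trans (term≤∑ l (f ∘ suc) i<l) (ℕP.m≤n+m _ (f 0))

count-true : ∀ {A : Set} (xs : List A) → count (λ _ → true) xs ≡ length xs
count-true []       = refl
count-true (x ∷ xs) = cong suc (count-true xs)

module _ {A : Set} where

  sumℚ-cong : ∀ {f g : A → ℚ} → (∀ x → f x ≡ g x) → ∀ xs → sumℚ (map f xs) ≡ sumℚ (map g xs)
  sumℚ-cong f≡g []       = refl
  sumℚ-cong f≡g (x ∷ xs) = cong₂ ℚ._+_ (f≡g x) (sumℚ-cong f≡g xs)

  sumℚ-mono : ∀ {f g : A → ℚ} {xs} → All (λ x → f x ℚ.≤ g x) xs → sumℚ (map f xs) ℚ.≤ sumℚ (map g xs)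
  sumℚ-mono []         = ℚP.≤-refl
  sumℚ-mono (p ∷ ps) = ℚP.+-mono-≤ p (sumℚ-mono ps)

  sumℚ-*ˡ : ∀ a (f : A → ℚ) xs → a ℚ.* sumℚ (map f xs) ≡ sumℚ (map (λ x → a ℚ.* f x) xs)
  sumℚ-*ˡ a f []       = ℚP.*-zeroʳ a
  sumℚ-*ˡ a f (x ∷ xs) = trans (ℚP.*-distribˡ-+ a (f x) _) (cong (a ℚ.* f x ℚ.+_) (sumℚ-*ˡ a f xs))

  sumℚ-*ʳ : ∀ a (f : A → ℚ) xs → sumℚ (map f xs) ℚ.* a ≡ sumℚ (map (λ x → f x ℚ.* a) xs)
  sumℚ-*ʳ a f []       = ℚP.*-zeroˡ a
  sumℚ-*ʳ a f (x ∷ xs) = trans (ℚP.*-distribʳ-+ a (f x) _) (cong (f x ℚ.* a ℚ.+_) (sumℚ-*ʳ a f xs))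

  sumℚ-+ : ∀ (f g : A → ℚ) xs → sumℚ (map f xs) ℚ.+ sumℚ (map g xs) ≡ sumℚ (map (λ x → f x ℚ.+ g x) xs)
  sumℚ-+ f g []       = ℚP.+-identityˡ 0ℚ
  sumℚ-+ f g (x ∷ xs) = trans (ℚ-+-interchange (f x) _ (g x) _) (cong (f x ℚ.+ g x ℚ.+_) (sumℚ-+ f g xs))

  sumℚ-0 : ∀ (xs : List A) → sumℚ (map (λ _ → 0ℚ) xs) ≡ 0ℚ
  sumℚ-0 []       = refl
  sumℚ-0 (x ∷ xs) = trans (ℚP.+-identityˡ _) (sumℚ-0 xs)

  sumℚ-indicator : ∀ (B : A → Bool) {M} → 0 < M → ∀ xs →
    sumℚ (map (λ x → if B x then fracℕ 1 M else 0ℚ) xs) ≡ fracℕ (count B xs) M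
  sumℚ-indicator B {M} M>0 []       = sym (fracℕ-0 M)
  sumℚ-indicator B {M} M>0 (x ∷ xs) =
    trans (cong ((if B x then fracℕ 1 M else 0ℚ) ℚ.+_) (sumℚ-indicator B M>0 xs)) (add (B x))
    where
    add : ∀ b → (if b then fracℕ 1 M else 0ℚ) ℚ.+ fracℕ (count B xs) M ≡ fracℕ (𝟙 b + count B xs) M
    add true  = fracℕ-+ 1 (count B xs) M>0
    add false = ℚP.+-identityˡ _

  sumℚ-scaled-indicator : ∀ (B : A → Bool) {M} → 0 < M → ∀ t xs →
    sumℚ (map (λ x → fracℕ 1 M ℚ.* (if B x then t else 0ℚ)) xs) ≡ fracℕ (count B xs) M ℚ.* t
  sumℚ-scaled-indicator B {M} M>0 t xs = begin
    sumℚ (map (λ x → fracℕ 1 M ℚ.* (if B x then t else 0ℚ)) xs)   ≡⟨ sumℚ-cong commute xs ⟩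
    sumℚ (map (λ x → (if B x then fracℕ 1 M else 0ℚ) ℚ.* t) xs)   ≡⟨ sumℚ-*ʳ t _ xs ⟨
    sumℚ (map (λ x → if B x then fracℕ 1 M else 0ℚ) xs) ℚ.* t     ≡⟨ cong (ℚ._* t) (sumℚ-indicator B M>0 xs) ⟩
    fracℕ (count B xs) M ℚ.* t                                    ∎
    where
    open ≡-Reasoning
    commute : ∀ x → fracℕ 1 M ℚ.* (if B x then t else 0ℚ) ≡ (if B x then fracℕ 1 M else 0ℚ) ℚ.* t
    commute x with B x
    ... | true  = refl
    ... | false = trans (ℚP.*-zeroʳ (fracℕ 1 M)) (sym (ℚP.*-zeroˡ t))

sumℚ-swap : ∀ {A B : Set} (F : A → B → ℚ) xs zs →
  sumℚ (map (λ x → sumℚ (map (F x) zs)) xs) ≡ sumℚ (map (λ z → sumℚ (map (λ x → F x z) xs)) zs)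
sumℚ-swap F []       zs = sym (sumℚ-0 zs)
sumℚ-swap F (x ∷ xs) zs = trans (cong (sumℚ (map (F x) zs) ℚ.+_) (sumℚ-swap F xs zs)) (sumℚ-+ (F x) _ zs)

-- Search strategies on an interval

leaves : ∀ {a b} → Strat a b → ℕ
leaves leaf               = 1
leaves (node _ _ _ l r) = leaves l + leaves r

leaves≤2^height : ∀ {a b} (T : Strat a b) → leaves T ≤ 2 ^ height T
leaves≤2^height leaf               = s≤s z≤n
leaves≤2^height (node _ _ _ l r) = ℕP.+-mono-≤
  (ℕP.≤-trans (leaves≤2^height l) (ℕP.^-monoʳ-≤ 2 (ℕP.m≤m⊔n (height l) (height r))))
  (ℕP.≤-trans (leaves≤2^height r) (ℕP.≤-trans (ℕP.^-monoʳ-≤ 2 (ℕP.m≤n⊔m (height l) (height r)))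
                                              (ℕP.m≤m+n _ 0)))

covered⇒∈ : ∀ {a b} (T : Strat a b) {v} → covered T v ≡ true → a ≤ v × v ≤ b
covered⇒∈ {a} {b} leaf {v} eq with a ≡ᵇ b in a≡b | a ≡ᵇ v in a≡v
... | true | true = ℕP.≤-reflexive (≡ᵇ-true⇒≡ {a} a≡v)
                  , ℕP.≤-reflexive (trans (sym (≡ᵇ-true⇒≡ {a} a≡v)) (≡ᵇ-true⇒≡ {a} a≡b))
covered⇒∈ (node e a≤e e<b l r) {v} eq with covered l v in eqˡ
... | true  = proj₁ (covered⇒∈ l eqˡ) , ℕP.≤-trans (proj₂ (covered⇒∈ l eqˡ)) (ℕP.<⇒≤ e<b)
... | false = ℕP.≤-trans a≤e (ℕP.<⇒≤ (proj₁ (covered⇒∈ r eq))) , proj₂ (covered⇒∈ r eq)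

covered-below : ∀ {a b} (T : Strat a b) {v} → v < a → covered T v ≡ false
covered-below T v<a = BoolP.¬-not (λ eq → ℕP.<⇒≱ v<a (proj₁ (covered⇒∈ T eq)))

covered-above : ∀ {a b} (T : Strat a b) {v} → b < v → covered T v ≡ false
covered-above T b<v = BoolP.¬-not (λ eq → ℕP.<⇒≱ b<v (proj₂ (covered⇒∈ T eq)))

-- A vertex satisfying leftEnd is the left end of a leaf (a singleton leaf, a itself, or the
-- successor of a singleton leaf), so each leaf contains at most one of them.
leftEnd : ∀ {a b} → Strat a b → ℕ → Bool
leftEnd {a} T v = covered T v ∨ ((v ≡ᵇ a) ∨ covered T (v ∸ 1))

leftEnd-node-left : ∀ {a b e a≤e e<b} (l : Strat a e) (r : Strat (suc e) b) {v} → v ≤ e →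
  leftEnd (node e a≤e e<b l r) v ≡ leftEnd l v
leftEnd-node-left l r {v} v≤e
  rewrite covered-below r (s≤s v≤e) | covered-below r (s≤s (ℕP.≤-trans (ℕP.m∸n≤m v 1) v≤e))
        | BoolP.∨-identityʳ (covered l v) | BoolP.∨-identityʳ (covered l (v ∸ 1)) = refl

leftEnd-node-right : ∀ {a b e a≤e e<b} (l : Strat a e) (r : Strat (suc e) b) {v} → suc e ≤ v →
  leftEnd (node e a≤e e<b l r) v ≡ true → leftEnd r v ≡ true
leftEnd-node-right {e = e} {a≤e = a≤e} l r {v} e<v h with v ℕ.≟ suc e
... | yes refl rewrite ≡ᵇ-refl e = BoolP.∨-zeroʳ (covered r (suc e))
... | no v≢1+e
  rewrite covered-above l (ℕP.<-≤-trans (ℕP.n<1+n e) e<v)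
        | covered-above l (ℕP.∸-monoˡ-≤ 1 (ℕP.≤∧≢⇒< e<v (λ eq → v≢1+e (sym eq))))
        | ≢⇒≡ᵇ-false (λ v≡a → ℕP.<⇒≢ (ℕP.≤-<-trans a≤e e<v) (sym v≡a)) | ≢⇒≡ᵇ-false v≢1+e = h

∑leftEnd≤leaves : ∀ {a b} (T : Strat a b) len → a + len ≡ b → ∑[ i < suc len ] 𝟙 (leftEnd T (a + i)) ≤ leaves T
∑leftEnd≤leaves {a} {b} leaf zero _ = ℕP.+-mono-≤ (𝟙≤1 (leftEnd (leaf {a} {b}) (a + 0))) z≤n
∑leftEnd≤leaves {a} {b} leaf (suc len) a+len≡b =
  ℕP.+-mono-≤ (𝟙≤1 (leftEnd (leaf {a} {b}) (a + 0))) (ℕP.≤-reflexive (∑-zero (suc len) nothing-after-a))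
  where
  a≢b : a ≢ b
  a≢b a≡b = ℕP.m+1+n≢m a (trans a+len≡b (sym a≡b))
  nothing-after-a : ∀ i → i < suc len → 𝟙 (leftEnd (leaf {a} {b}) (a + suc i)) ≡ 0
  nothing-after-a i _ rewrite ≢⇒≡ᵇ-false a≢b | ≢⇒≡ᵇ-false (ℕP.m+1+n≢m a {i}) = refl
∑leftEnd≤leaves {a} {b} T@(node e a≤e e<b l r) len a+len≡b = begin
  sum< (suc len) f                                       ≡⟨ cong (λ m → sum< m f) len-split ⟩
  sum< (suc l₁ + suc l₂) f                               ≡⟨ ∑-split (suc l₁) (suc l₂) f ⟩
  sum< (suc l₁) f + ∑[ i < suc l₂ ] f (suc l₁ + i)       ≤⟨ ℕP.+-mono-≤
      (ℕP.≤-trans (∑-mono (suc l₁) on-left) (∑leftEnd≤leaves l l₁ a+l₁≡e))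
      (ℕP.≤-trans (∑-mono (suc l₂) on-right) (∑leftEnd≤leaves r l₂ e+l₂≡b)) ⟩
  leaves l + leaves r                                    ∎
  where
  open ℕP.≤-Reasoning
  f : ℕ → ℕ
  f i = 𝟙 (leftEnd T (a + i))
  l₁ = e ∸ a
  l₂ = b ∸ suc e
  a+l₁≡e : a + l₁ ≡ e
  a+l₁≡e = ℕP.m+[n∸m]≡n a≤e
  e+l₂≡b : suc e + l₂ ≡ b
  e+l₂≡b = ℕP.m+[n∸m]≡n e<b
  a+l₁+i : ∀ i → a + (suc l₁ + i) ≡ suc e + i
  a+l₁+i i = trans (sym (ℕP.+-assoc a (suc l₁) i)) (cong (_+ i) (trans (ℕP.+-suc a l₁) (cong suc a+l₁≡e)))
  len-split : suc len ≡ suc l₁ + suc l₂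
  len-split = cong suc (ℕP.+-cancelˡ-≡ a len (l₁ + suc l₂)
    (trans a+len≡b (trans (sym e+l₂≡b) (trans (sym (a+l₁+i l₂)) (cong (a +_) (sym (ℕP.+-suc l₁ l₂)))))))
  on-left : ∀ i → i < suc l₁ → f i ≤ 𝟙 (leftEnd l (a + i))
  on-left i (s≤s i≤l₁) = ℕP.≤-reflexive (cong 𝟙 (leftEnd-node-left {a≤e = a≤e} {e<b} l r
    (subst (a + i ≤_) a+l₁≡e (ℕP.+-monoʳ-≤ a i≤l₁))))
  on-right : ∀ i → i < suc l₂ → f (suc l₁ + i) ≤ 𝟙 (leftEnd r (suc e + i))
  on-right i _ = 𝟙-mono (λ h → leftEnd-node-right {a≤e = a≤e} {e<b} l r (ℕP.m≤m+n (suc e) i)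
    (subst (λ v → leftEnd T v ≡ true) (a+l₁+i i) h))

2^[_]-1 : ℕ → ℕ
2^[ zero  ]-1 = 0
2^[ suc h ]-1 = 2^[ h ]-1 + suc 2^[ h ]-1

1+2^[_]-1 : ∀ h → suc 2^[ h ]-1 ≡ 2 ^ h
1+2^[ zero  ]-1 = refl
1+2^[ suc h ]-1 = begin
  suc 2^[ h ]-1 + suc 2^[ h ]-1    ≡⟨ cong (λ m → m + m) (1+2^[ h ]-1) ⟩
  2 ^ h + 2 ^ h                    ≡⟨ cong (2 ^ h +_) (ℕP.+-identityʳ (2 ^ h)) ⟨
  2 ^ suc h                        ∎
  where open ≡-Reasoning

halves : ∀ a h → suc (a + 2^[ h ]-1) + 2^[ h ]-1 ≡ a + 2^[ suc h ]-1
halves a h = trans (sym (ℕP.+-suc (a + 2^[ h ]-1) 2^[ h ]-1)) (ℕP.+-assoc a 2^[ h ]-1 (suc 2^[ h ]-1))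

complete : ∀ h a b → a + 2^[ h ]-1 ≡ b → Strat a b
complete zero    a b _  = leaf
complete (suc h) a b eq = node (a + 2^[ h ]-1) (ℕP.m≤m+n a _) mid<b
  (complete h a _ refl) (complete h _ b (trans (halves a h) eq))
  where
  mid<b : a + 2^[ h ]-1 < b
  mid<b = subst (a + 2^[ h ]-1 <_) (trans (halves a h) eq) (ℕP.m≤m+n _ _)

complete-height : ∀ h a b eq → height (complete h a b eq) ≤ h
complete-height zero    a b eq = z≤n
complete-height (suc h) a b eq = s≤s (ℕP.⊔-lub (complete-height h _ _ _) (complete-height h _ _ _))

complete-covered : ∀ h a b eq {v} → a ≤ v → v ≤ b → covered (complete h a b eq) v ≡ true
complete-covered zero a b refl {v} a≤v v≤b
  with refl ← ℕP.≤-antisym a≤v (subst (v ≤_) (ℕP.+-identityʳ a) v≤b)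
  rewrite ℕP.+-identityʳ a | ≡ᵇ-refl a = refl
complete-covered (suc h) a b eq {v} a≤v v≤b with v ℕ.≤? a + 2^[ h ]-1
... | yes v≤mid rewrite complete-covered h a _ refl a≤v v≤mid = refl
... | no  v≰mid = trans (cong (covered (complete h a _ refl) v ∨_)
                              (complete-covered h _ b _ (ℕP.≰⇒> v≰mid) v≤b))
                        (BoolP.∨-zeroʳ _)

coverPrefix : ∀ h a b → a + 2^[ h ]-1 < b → Strat a b
coverPrefix zero    a b _   = leaf
coverPrefix (suc h) a b lt = node (a + 2^[ h ]-1) (ℕP.m≤m+n a _)
  (ℕP.<-trans (ℕP.m≤m+n _ _) rest<b) (complete h a _ refl) (coverPrefix h _ b rest<b)
  where
  rest<b : suc (a + 2^[ h ]-1) + 2^[ h ]-1 < b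
  rest<b = subst (_< b) (sym (halves a h)) lt

coverPrefix-height : ∀ h a b lt → height (coverPrefix h a b lt) ≤ h
coverPrefix-height zero    a b lt = z≤n
coverPrefix-height (suc h) a b lt = s≤s (ℕP.⊔-lub (complete-height h _ _ _) (coverPrefix-height h _ _ _))

coverPrefix-covered : ∀ h a b lt {v} → a ≤ v → v < a + 2^[ h ]-1 → covered (coverPrefix h a b lt) v ≡ true
coverPrefix-covered zero a b lt a≤v v<a = ⊥-elim (ℕP.<⇒≱ v<a (subst (_≤ _) (sym (ℕP.+-identityʳ a)) a≤v))
coverPrefix-covered (suc h) a b lt {v} a≤v v<end with v ℕ.≤? a + 2^[ h ]-1
... | yes v≤mid rewrite complete-covered h a _ refl a≤v v≤mid = refl
... | no  v≰mid = trans (cong (covered (complete h a _ refl) v ∨_)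
                              (coverPrefix-covered h _ b _ (ℕP.≰⇒> v≰mid) (subst (v <_) (sym (halves a h)) v<end)))
                        (BoolP.∨-zeroʳ _)

coverPrefix-uncovered : ∀ h a b lt {v} → a + 2^[ h ]-1 ≤ v → covered (coverPrefix h a b lt) v ≡ false
coverPrefix-uncovered zero a b lt end≤v
  rewrite ≢⇒≡ᵇ-false (λ a≡b → ℕP.<⇒≢ (subst (_< b) (ℕP.+-identityʳ a) lt) a≡b) = refl
coverPrefix-uncovered (suc h) a b lt {v} end≤v
  rewrite covered-above (complete h a _ refl)
            (ℕP.<-≤-trans (s≤s (ℕP.m≤m+n _ 2^[ h ]-1)) (subst (_≤ v) (sym (halves a h)) end≤v))
  = coverPrefix-uncovered h _ b _ (subst (_≤ v) (sym (halves a h)) end≤v)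

-- Multiples of d and runs of covered vertices

≤-of-budget : ∀ D u p q → u ≤ D * p → u + p ≤ q * suc D + 1 → u ≤ D * q
≤-of-budget D u p q u≤Dp budget with D * q ℕ.<? u
... | no  u≯Dq = ℕP.≮⇒≥ u≯Dq
... | yes Dq<u = ⊥-elim (ℕP.<⇒≱ over budget)
  where
  q<p : q < p
  q<p = ℕP.*-cancelˡ-< D q p (ℕP.<-≤-trans Dq<u u≤Dp)
  rearrange : ∀ D q → suc (D * q) + suc q ≡ suc (q * suc D + 1)
  rearrange = ℕSolver.solve-∀
  over : q * suc D + 1 < u + p
  over = subst (_≤ u + p) (rearrange D q) (ℕP.+-mono-≤ Dq<u q<p)

module Multiples (d : ℕ) (d>0 : 0 < d) where

  D : ℕ
  D = d ∸ 1

  d≡1+D : d ≡ suc D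
  d≡1+D = sym (ℕP.m+[n∸m]≡n d>0)

  nonMultiple : ℕ → Bool
  nonMultiple v = not (does (d ∣? v))

  multiple⇒nonMultiple-false : ∀ {v} → d ∣ v → nonMultiple v ≡ false
  multiple⇒nonMultiple-false {v} d∣v rewrite dec-true (d ∣? v) d∣v = refl

  ∤-inside-block : ∀ j {t} → 0 < t → t < d → ¬ d ∣ j * d + t
  ∤-inside-block j t>0 t<d d∣ = ℕP.<⇒≱ t<d (∣⇒≤ {{ℕ.>-nonZero t>0}} (∣m+n∣m⇒∣n d∣ (n∣m*n j)))

  nonMultiple-inside-block : ∀ j {t} → 0 < t → t < d → nonMultiple (j * d + t) ≡ true
  nonMultiple-inside-block j {t} t>0 t<d
    rewrite dec-false (d ∣? (j * d + t)) (∤-inside-block j t>0 t<d) = refl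

  block-end : ∀ j → suc (j * d + D) ≡ suc j * d
  block-end j = begin
    suc (j * d + D)        ≡⟨ ℕP.+-suc (j * d) D ⟨
    j * d + suc D          ≡⟨ cong (j * d +_) d≡1+D ⟨
    j * d + d              ≡⟨ ℕP.+-comm (j * d) d ⟩
    suc j * d              ∎
    where open ≡-Reasoning

  ∑-block : ∀ (f : ℕ → ℕ) j →
    ∑[ i < d ] f (suc (j * d + i)) ≡ ∑[ i < D ] f (suc (j * d + i)) + f (suc j * d)
  ∑-block f j = begin
    sum< d g                          ≡⟨ cong (λ m → sum< m g) (trans d≡1+D (ℕP.+-comm 1 D)) ⟩
    sum< (D + 1) g                    ≡⟨ ∑-split D 1 g ⟩
    sum< D g + (g (D + 0) + 0)        ≡⟨ cong (sum< D g +_) (ℕP.+-identityʳ _) ⟩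
    sum< D g + g (D + 0)              ≡⟨ cong (λ m → sum< D g + g m) (ℕP.+-identityʳ D) ⟩
    sum< D g + g D                    ≡⟨ cong (λ m → sum< D g + f m) (block-end j) ⟩
    sum< D g + f (suc j * d)          ∎
    where
    open ≡-Reasoning
    g : ℕ → ℕ
    g i = f (suc (j * d + i))

  ∑-nonMultiple-block : ∀ j → ∑[ i < d ] 𝟙 (nonMultiple (suc (j * d + i))) ≡ D
  ∑-nonMultiple-block j = begin
    ∑[ i < d ] 𝟙 (nonMultiple (suc (j * d + i)))                        ≡⟨ ∑-block (𝟙 ∘ nonMultiple) j ⟩
    ∑[ i < D ] 𝟙 (nonMultiple (suc (j * d + i))) + 𝟙 (nonMultiple (suc j * d))
      ≡⟨ cong₂ _+_ (∑-cong D inside) (cong 𝟙 (multiple⇒nonMultiple-false (n∣m*n (suc j)))) ⟩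
    ∑[ i < D ] 1 + 0                                                    ≡⟨ ℕP.+-identityʳ _ ⟩
    ∑[ i < D ] 1                                                        ≡⟨ ∑-const D 1 ⟩
    D * 1                                                               ≡⟨ ℕP.*-identityʳ D ⟩
    D                                                                   ∎
    where
    open ≡-Reasoning
    inside : ∀ i → i < D → 𝟙 (nonMultiple (suc (j * d + i))) ≡ 1
    inside i i<D = cong 𝟙 (subst (λ v → nonMultiple v ≡ true) (ℕP.+-suc (j * d) i)
      (nonMultiple-inside-block j (s≤s z≤n) (subst (suc i <_) (sym d≡1+D) (s≤s i<D))))

  ∑-nonMultiple : ∀ w → ∑[ v < suc (w * d) ] 𝟙 (nonMultiple v) ≡ w * D
  ∑-nonMultiple w = begin
    𝟙 (nonMultiple 0) + ∑[ v < w * d ] 𝟙 (nonMultiple (suc v))    ≡⟨ cong (λ b → 𝟙 b + rest) 0-multiple ⟩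
    ∑[ v < w * d ] 𝟙 (nonMultiple (suc v))                        ≡⟨ ∑-blocks w d (λ v → 𝟙 (nonMultiple (suc v))) ⟩
    ∑[ j < w ] ∑[ i < d ] 𝟙 (nonMultiple (suc (j * d + i)))       ≡⟨ ∑-cong w (λ j _ → ∑-nonMultiple-block j) ⟩
    ∑[ j < w ] D                                                  ≡⟨ ∑-const w D ⟩
    w * D                                                         ∎
    where
    open ≡-Reasoning
    rest = ∑[ v < w * d ] 𝟙 (nonMultiple (suc v))
    0-multiple : nonMultiple 0 ≡ false
    0-multiple = multiple⇒nonMultiple-false (n∣m*n 0)

  module Runs (cv : ℕ → Bool) where

    starts : ℕ → Bool
    starts v = cv v ∨ ((v ≡ᵇ 0) ∨ cv (v ∸ 1))

    hit : ℕ → Bool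
    hit v = cv v ∧ nonMultiple v

    -- Every maximal run of hits ends, at the latest at the next multiple of d, in a barrier.
    barrier : ℕ → Bool
    barrier v = starts v ∧ not (hit v)

    𝟙-starts : ∀ v → 𝟙 (starts v) ≡ 𝟙 (hit v) + 𝟙 (barrier v)
    𝟙-starts v with cv v | nonMultiple v
    ... | true  | true  = refl
    ... | true  | false = refl
    ... | false | _     = cong 𝟙 (sym (BoolP.∧-identityʳ ((v ≡ᵇ 0) ∨ cv (v ∸ 1))))

    covered-multiple-barrier : ∀ {v} → d ∣ v → cv v ≡ true → barrier v ≡ true
    covered-multiple-barrier d∣v cv-v rewrite cv-v | multiple⇒nonMultiple-false d∣v = refl

    barrier-ahead : ∀ m v → d ∣ v + m → cv v ≡ true → Σ ℕ λ i → i ≤ m × barrier (v + i) ≡ true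
    barrier-ahead zero v d∣v cv-v = 0 , z≤n , subst (λ u → barrier u ≡ true) (sym (ℕP.+-identityʳ v))
      (covered-multiple-barrier (subst (d ∣_) (ℕP.+-identityʳ v) d∣v) cv-v)
    barrier-ahead (suc m) v d∣ cv-v with cv (suc v) in cv-sv
    ... | true  = let (i , i≤m , bar) = barrier-ahead m (suc v) (subst (d ∣_) (ℕP.+-suc v m) d∣) cv-sv
                  in suc i , s≤s i≤m , subst (λ u → barrier u ≡ true) (sym (ℕP.+-suc v i)) bar
    ... | false = 1 , s≤s z≤n , subst (λ u → barrier u ≡ true) (ℕP.+-comm 1 v) after-run
      where
      after-run : barrier (suc v) ≡ true
      after-run rewrite cv-sv | cv-v = refl

    hit⇒covered : ∀ {v} → hit v ≡ true → cv v ≡ true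
    hit⇒covered {v} h with cv v
    ... | true = refl

    hit⇒nonMultiple : ∀ {v} → hit v ≡ true → nonMultiple v ≡ true
    hit⇒nonMultiple {v} h with cv v
    ... | true = h

    hit-0 : hit 0 ≡ false
    hit-0 rewrite multiple⇒nonMultiple-false (n∣m*n 0) = BoolP.∧-zeroʳ (cv 0)

    barrier-0 : barrier 0 ≡ true
    barrier-0 rewrite hit-0 = trans (BoolP.∧-identityʳ _) (BoolP.∨-zeroʳ (cv 0))

    barrier-in-block : ∀ j i → i < d → cv (suc (j * d + i)) ≡ true → 1 ≤ ∑[ i < d ] 𝟙 (barrier (suc (j * d + i)))
    barrier-in-block j i i<d cv-v = ℕP.≤-trans (subst (λ b → 1 ≤ 𝟙 b) (sym bar′) ℕP.≤-refl)
                                               (term≤∑ d (λ i → 𝟙 (barrier (suc (j * d + i)))) i+i′<d)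
      where
      i≤D : i ≤ D
      i≤D = ℕP.≤-pred (subst (i <_) d≡1+D i<d)
      to-end : d ∣ suc (j * d + i) + (D ∸ i)
      to-end = subst (d ∣_) (begin
        suc j * d                      ≡⟨ block-end j ⟨
        suc (j * d + D)                ≡⟨ cong (λ m → suc (j * d + m)) (ℕP.m+[n∸m]≡n i≤D) ⟨
        suc (j * d + (i + (D ∸ i)))    ≡⟨ cong suc (ℕP.+-assoc (j * d) i (D ∸ i)) ⟨
        suc (j * d + i) + (D ∸ i)      ∎) (n∣m*n (suc j))
        where open ≡-Reasoning
      ahead = barrier-ahead (D ∸ i) (suc (j * d + i)) to-end cv-v
      i′ = proj₁ ahead
      bar′ : barrier (suc (j * d + (i + i′))) ≡ true
      bar′ = subst (λ m → barrier (suc m) ≡ true) (ℕP.+-assoc (j * d) i i′) (proj₂ (proj₂ ahead))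
      i+i′<d : i + i′ < d
      i+i′<d = subst (i + i′ <_) (sym d≡1+D)
        (s≤s (subst (i + i′ ≤_) (ℕP.m+[n∸m]≡n i≤D) (ℕP.+-monoʳ-≤ i (proj₁ (proj₂ ahead)))))

    ∑-hit-block : ∀ j → ∑[ i < d ] 𝟙 (hit (suc (j * d + i))) ≤ D * ∑[ i < d ] 𝟙 (barrier (suc (j * d + i)))
    ∑-hit-block j with ∑[ i < d ] 𝟙 (barrier (suc (j * d + i))) in barriers
    ... | zero  = ℕP.≤-trans (ℕP.≤-reflexive (∑-zero d no-hit)) z≤n
      where
      no-hit : ∀ i → i < d → 𝟙 (hit (suc (j * d + i))) ≡ 0
      no-hit i i<d with hit (suc (j * d + i)) in h
      ... | false = refl
      ... | true  = ⊥-elim (ℕP.<⇒≱ (subst (0 <_) barriers (barrier-in-block j i i<d (hit⇒covered h))) z≤n)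
    ... | suc p = ℕP.≤-trans hits≤D (ℕP.m≤m*n D (suc p))
      where
      hits≤D : ∑[ i < d ] 𝟙 (hit (suc (j * d + i))) ≤ D
      hits≤D = ℕP.≤-trans (∑-mono d (λ i _ → 𝟙-mono hit⇒nonMultiple)) (ℕP.≤-reflexive (∑-nonMultiple-block j))

    hits≤ : ∀ w q → ∑[ v < suc (w * d) ] 𝟙 (starts v) ≤ q * d + 2 → ∑[ v < suc (w * d) ] 𝟙 (hit v) ≤ D * q
    hits≤ w q budget = ≤-of-budget D u p q u≤Dp u+p≤
      where
      open ℕP.≤-Reasoning
      H B : ℕ → ℕ
      H j = ∑[ i < d ] 𝟙 (hit (suc (j * d + i)))
      B j = ∑[ i < d ] 𝟙 (barrier (suc (j * d + i)))
      u p : ℕ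
      u = ∑[ v < suc (w * d) ] 𝟙 (hit v)
      p = sum< w B
      u≤Dp : u ≤ D * p
      u≤Dp = begin
        𝟙 (hit 0) + ∑[ v < w * d ] 𝟙 (hit (suc v))   ≡⟨ cong (λ b → 𝟙 b + ∑[ v < w * d ] 𝟙 (hit (suc v))) hit-0 ⟩
        ∑[ v < w * d ] 𝟙 (hit (suc v))               ≡⟨ ∑-blocks w d (λ v → 𝟙 (hit (suc v))) ⟩
        sum< w H                                     ≤⟨ ∑-mono w (λ j _ → ∑-hit-block j) ⟩
        ∑[ j < w ] (D * B j)                         ≡⟨ ∑-*ˡ D w B ⟩
        D * p                                        ∎
      barriers : ∑[ v < suc (w * d) ] 𝟙 (barrier v) ≡ suc p
      barriers = cong₂ _+_ (cong 𝟙 barrier-0) (∑-blocks w d (λ v → 𝟙 (barrier (suc v))))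
      u+p≤ : u + p ≤ q * suc D + 1
      u+p≤ = ℕP.≤-pred (begin
        suc (u + p)                                          ≡⟨ ℕP.+-suc u p ⟨
        u + suc p                                            ≡⟨ cong (u +_) barriers ⟨
        u + ∑[ v < suc (w * d) ] 𝟙 (barrier v)                ≡⟨ ∑-+ (suc (w * d)) (𝟙 ∘ hit) (𝟙 ∘ barrier) ⟨
        ∑[ v < suc (w * d) ] (𝟙 (hit v) + 𝟙 (barrier v))      ≡⟨ ∑-cong (suc (w * d)) (λ v _ → 𝟙-starts v) ⟨
        ∑[ v < suc (w * d) ] 𝟙 (starts v)                     ≤⟨ budget ⟩
        q * d + 2                                            ≡⟨ cong (λ m → q * m + 2) d≡1+D ⟩
        q * suc D + 2                                        ≡⟨ ℕP.+-suc (q * suc D) 1 ⟩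
        suc (q * suc D + 1)                                  ∎)

-- Windows on the cycle ℤ/N

residue-unique : ∀ {N x y} a b .{{_ : NonZero N}} → x < N → y < N → x + a * N ≡ y + b * N → x ≡ y
residue-unique {N} {x} {y} a b x<N y<N eq = begin
  x                  ≡⟨ m<n⇒m%n≡m x<N ⟨
  x % N              ≡⟨ [m+kn]%n≡m%n x a N ⟨
  (x + a * N) % N    ≡⟨ cong (_% N) eq ⟩
  (y + b * N) % N    ≡⟨ [m+kn]%n≡m%n y b N ⟩
  y % N              ≡⟨ m<n⇒m%n≡m y<N ⟩
  y                  ∎
  where open ≡-Reasoning

offset-mod : ∀ {s z n} .{{_ : NonZero n}} → s ≤ z → z < n → (s + (z ∸ s)) % n ≡ z
offset-mod {n = n} s≤z z<n = trans (cong (_% n) (ℕP.m+[n∸m]≡n s≤z)) (m<n⇒m%n≡m z<n)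

module CircularWindows (N c : ℕ) .{{_ : NonZero N}} where

  step : ℕ → ℕ
  step s = (s + c) % N

  walk : ℕ → ℕ → List ℕ
  walk zero    v = []
  walk (suc f) v = if v ≤ᵇ 1 then [] else v ∷ walk f (step v)

  walkEnd : ℕ → ℕ → ℕ
  walkEnd zero    v = v
  walkEnd (suc f) v = if v ≤ᵇ 1 then v else walkEnd f (step v)

  gap : ℕ → ℕ → ℕ
  gap z s = if s ≤ᵇ z then z ∸ s else (z + N) ∸ s

  wraps : ℕ → ℕ → ℕ
  wraps z s = if s ≤ᵇ z then 0 else 1

  inWindow : ℕ → ℕ → Bool
  inWindow z s = gap z s <ᵇ c

  gap<N : ∀ {z s} → z < N → s < N → gap z s < N
  gap<N {z} {s} z<N s<N with s ≤ᵇ z in s≤?z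
  ... | true  = ℕP.≤-<-trans (ℕP.m∸n≤m z s) z<N
  ... | false = ℕP.m<n+o⇒m∸n<o (z + N) s (ℕP.+-monoˡ-< N (≤ᵇ-false⇒> {s} s≤?z))

  gap+s : ∀ {z s} → s < N → gap z s + s ≡ z + wraps z s * N
  gap+s {z} {s} s<N with s ≤ᵇ z in s≤?z
  ... | true  = trans (ℕP.m∸n+n≡m (≤ᵇ-true⇒≤ {s} s≤?z)) (sym (ℕP.+-identityʳ z))
  ... | false = trans (ℕP.m∸n+n≡m (ℕP.≤-trans (ℕP.<⇒≤ s<N) (ℕP.m≤n+m N z)))
                      (cong (z +_) (sym (ℕP.+-identityʳ N)))

  step+carry : ∀ s → step s + ((s + c) / N) * N ≡ s + c
  step+carry s = sym (m≡m%n+[m/n]*n (s + c) N)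

  gap-step-congruent : ∀ {z s} → s < N → step s < N →
    (gap z (step s) + c) + wraps z s * N ≡ gap z s + (wraps z (step s) + (s + c) / N) * N
  gap-step-congruent {z} {s} s<N t<N = ℕP.+-cancelʳ-≡ s _ _ (begin
    g′ + c + σ * N + s                ≡⟨ shuffle₁ g′ c σ N s ⟩
    g′ + (s + c) + σ * N              ≡⟨ cong (λ m → g′ + m + σ * N) (step+carry s) ⟨
    g′ + (t + Q * N) + σ * N          ≡⟨ shuffle₂ g′ t Q N σ ⟩
    (g′ + t) + Q * N + σ * N          ≡⟨ cong (λ m → m + Q * N + σ * N) (gap+s t<N) ⟩
    z + σ′ * N + Q * N + σ * N        ≡⟨ shuffle₃ z σ′ N Q σ ⟩
    (z + σ * N) + (σ′ + Q) * N        ≡⟨ cong (_+ (σ′ + Q) * N) (gap+s s<N) ⟨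
    (gap z s + s) + (σ′ + Q) * N      ≡⟨ shuffle₄ (gap z s) s (σ′ + Q) N ⟩
    gap z s + (σ′ + Q) * N + s        ∎)
    where
    open ≡-Reasoning
    t = step s
    g′ = gap z t
    σ = wraps z s
    σ′ = wraps z t
    Q = (s + c) / N
    shuffle₁ : ∀ g c σ N s → g + c + σ * N + s ≡ g + (s + c) + σ * N
    shuffle₁ = ℕSolver.solve-∀
    shuffle₂ : ∀ g t Q N σ → g + (t + Q * N) + σ * N ≡ (g + t) + Q * N + σ * N
    shuffle₂ = ℕSolver.solve-∀
    shuffle₃ : ∀ z σ′ N Q σ → z + σ′ * N + Q * N + σ * N ≡ (z + σ * N) + (σ′ + Q) * N
    shuffle₃ = ℕSolver.solve-∀
    shuffle₄ : ∀ g s k N → (g + s) + k * N ≡ g + k * N + s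
    shuffle₄ = ℕSolver.solve-∀

  residue-in-window : ∀ {L R} a b → c < N → c ≤ L → L < N + c → R < N →
    L + a * N ≡ R + b * N → L ≡ R + 𝟙 (R <ᵇ c) * N
  residue-in-window {L} {R} a b c<N c≤L L<N+c R<N eq with L ℕ.<? N
  ... | yes L<N = trans L≡R (sym (trans (cong (λ x → R + 𝟙 x * N) (≥⇒<ᵇ-false (subst (c ≤_) L≡R c≤L)))
                                        (ℕP.+-identityʳ R)))
    where
    L≡R : L ≡ R
    L≡R = residue-unique a b L<N R<N eq
  ... | no  L≮N = begin
    L                    ≡⟨ ℕP.m∸n+n≡m N≤L ⟨
    L ∸ N + N            ≡⟨ cong (_+ N) L∸N≡R ⟩
    R + N                ≡⟨ cong (R +_) (ℕP.*-identityˡ N) ⟨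
    R + 1 * N            ≡⟨ cong (λ x → R + 𝟙 x * N) (<⇒<ᵇ-true (subst (_< c) L∸N≡R L∸N<c)) ⟨
    R + 𝟙 (R <ᵇ c) * N   ∎
    where
    open ≡-Reasoning
    N≤L : N ≤ L
    N≤L = ℕP.≮⇒≥ L≮N
    L∸N<c : L ∸ N < c
    L∸N<c = subst (L ∸ N <_) (ℕP.m+n∸m≡n N c) (ℕP.∸-monoˡ-< L<N+c N≤L)
    L∸N≡R : L ∸ N ≡ R
    L∸N≡R = residue-unique (suc a) b (ℕP.<-trans L∸N<c c<N) R<N
      (trans (sym (ℕP.+-assoc (L ∸ N) N (a * N))) (trans (cong (_+ a * N) (ℕP.m∸n+n≡m N≤L)) eq))

  gap-step : ∀ {z s} → c < N → z < N → s < N → gap z (step s) + c ≡ gap z s + 𝟙 (inWindow z s) * N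
  gap-step {z} {s} c<N z<N s<N = residue-in-window (wraps z s) (wraps z (step s) + (s + c) / N) c<N
    (ℕP.m≤n+m c _) (ℕP.+-monoˡ-< c (gap<N z<N t<N)) (gap<N z<N s<N) (gap-step-congruent s<N t<N)
    where
    t<N : step s < N
    t<N = m%n<n (s + c) N

  telescope : ∀ {z} → c < N → z < N → ∀ f {v} → v < N →
    gap z (walkEnd f v) + length (walk f v) * c ≡ gap z v + count (inWindow z) (walk f v) * N
  telescope         c<N z<N zero    v<N = refl
  telescope {z} c<N z<N (suc f) {v} v<N with v ≤ᵇ 1
  ... | true  = refl
  ... | false = begin
    gap z e + (c + len * c)                     ≡⟨ shuffle₁ (gap z e) c (len * c) ⟩
    (gap z e + len * c) + c                     ≡⟨ cong (_+ c) (telescope c<N z<N f t<N) ⟩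
    (gap z t + cnt * N) + c                     ≡⟨ shuffle₁ (gap z t) c (cnt * N) ⟨
    gap z t + (c + cnt * N)                     ≡⟨ shuffle₂ (gap z t) c (cnt * N) ⟩
    (gap z t + c) + cnt * N                     ≡⟨ cong (_+ cnt * N) (gap-step c<N z<N v<N) ⟩
    (gap z v + 𝟙 (inWindow z v) * N) + cnt * N   ≡⟨ shuffle₃ (gap z v) (𝟙 (inWindow z v)) cnt N ⟩
    gap z v + (𝟙 (inWindow z v) + cnt) * N       ∎
    where
    open ≡-Reasoning
    t = step v
    e = walkEnd f t
    len = length (walk f t)
    cnt = count (inWindow z) (walk f t)
    t<N : t < N
    t<N = m%n<n (v + c) N
    shuffle₁ : ∀ x y u → x + (y + u) ≡ (x + u) + y
    shuffle₁ = ℕSolver.solve-∀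
    shuffle₂ : ∀ x y u → x + (y + u) ≡ (x + y) + u
    shuffle₂ = ℕSolver.solve-∀
    shuffle₃ : ∀ x b k N → (x + b * N) + k * N ≡ x + (b + k) * N
    shuffle₃ = ℕSolver.solve-∀

  walk-bounds : ∀ f {v} → v < N → All (λ s → 2 ≤ s × s < N) (walk f v)
  walk-bounds zero    v<N = []
  walk-bounds (suc f) {v} v<N with v ≤ᵇ 1 in v≤?1
  ... | true  = []
  ... | false = (≤ᵇ-false⇒> {v} v≤?1 , v<N) ∷ walk-bounds f (m%n<n (v + c) N)

  cycle-count : ∀ {z} → c < N → 1 < N → z < N → ∀ f → walkEnd f (step 1) ≡ 1 →
    suc (length (walk f (step 1))) * c ≡ count (inWindow z) (1 ∷ walk f (step 1)) * N
  cycle-count {z} c<N 1<N z<N f returns = ℕP.+-cancelʳ-≡ (gap z 1 + gap z t) _ _ (begin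
    (c + len * c) + (gap z 1 + gap z t)        ≡⟨ shuffle₁ c (len * c) (gap z 1) (gap z t) ⟩
    (gap z 1 + len * c) + (gap z t + c)        ≡⟨ cong₂ _+_ around (gap-step c<N z<N 1<N) ⟩
    (gap z t + cnt * N) + (gap z 1 + b * N)    ≡⟨ shuffle₂ (gap z t) cnt N (gap z 1) b ⟩
    (b + cnt) * N + (gap z 1 + gap z t)        ∎)
    where
    open ≡-Reasoning
    t = step 1
    len = length (walk f t)
    cnt = count (inWindow z) (walk f t)
    b = 𝟙 (inWindow z 1)
    around : gap z 1 + len * c ≡ gap z t + cnt * N
    around = subst (λ e → gap z e + len * c ≡ gap z t + cnt * N) returns
                   (telescope c<N z<N f (m%n<n (1 + c) N))
    shuffle₁ : ∀ c l g₁ g₂ → (c + l) + (g₁ + g₂) ≡ (g₁ + l) + (g₂ + c)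
    shuffle₁ = ℕSolver.solve-∀
    shuffle₂ : ∀ g₂ k N g₁ b → (g₂ + k * N) + (g₁ + b * N) ≡ (b + k) * N + (g₁ + g₂)
    shuffle₂ = ℕSolver.solve-∀

  orbit : ℕ → ℕ
  orbit j = (1 + j * c) % N

  step-orbit : ∀ j → step (orbit j) ≡ orbit (suc j)
  step-orbit j = begin
    ((1 + j * c) % N + c) % N              ≡⟨ %-distribˡ-+ ((1 + j * c) % N) c N ⟩
    ((1 + j * c) % N % N + c % N) % N      ≡⟨ cong (λ x → (x + c % N) % N) (m%n%n≡m%n (1 + j * c) N) ⟩
    ((1 + j * c) % N + c % N) % N          ≡⟨ %-distribˡ-+ (1 + j * c) c N ⟨
    (1 + j * c + c) % N                    ≡⟨ cong (_% N) (shuffle j c) ⟩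
    (1 + suc j * c) % N                    ∎
    where
    open ≡-Reasoning
    shuffle : ∀ j c → 1 + j * c + c ≡ 1 + (c + j * c)
    shuffle = ℕSolver.solve-∀

  walkEnd-orbit : ∀ w → orbit w ≡ 1 → (∀ j → orbit j ≢ 0) →
    ∀ f j → j ≤ w → w ≤ j + f → walkEnd f (orbit j) ≡ 1
  walkEnd-orbit w returns never-0 zero j j≤w w≤j+0
    rewrite ℕP.≤-antisym j≤w (subst (w ≤_) (ℕP.+-identityʳ j) w≤j+0) = returns
  walkEnd-orbit w returns never-0 (suc f) j j≤w w≤j+f with orbit j ≤ᵇ 1 in orbit≤?1
  ... | true  = ≤ᵇ1∧≢0⇒≡1 orbit≤?1 (never-0 j)
  ... | false = subst (λ v → walkEnd f v ≡ 1) (sym (step-orbit j))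
      (walkEnd-orbit w returns never-0 f (suc j) (ℕP.≤∧≢⇒< j≤w j≢w) (subst (w ≤_) (ℕP.+-suc j f) w≤j+f))
    where
    j≢w : j ≢ w
    j≢w j≡w with () ← trans (sym (cong (_≤ᵇ 1) (trans (cong orbit j≡w) returns))) orbit≤?1

-- The game of Theorem 3.1

module _ {n k c v : ℕ} {T : StratG n} (isTv : IsTv n k c v T) where

  private
    Extended : Set
    Extended = InInterval n v (suc c) 0 ⊎ InInterval n v (suc c) (n ∸ 1)

  Tv-covers-extended : Extended → ∀ {z} → InInterval n v (suc c) z → covered T z ≡ true
  Tv-covers-extended ext {z} = proj₂ (proj₁ (proj₂ isTv) ext z)

  private
    widen : ∀ {u} → InInterval n v c u → InInterval n v (suc c) u
    widen (i , i<c , eq) = i , ℕP.m≤n⇒m≤1+n i<c , eq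

    uncovered⇒not-extended : ∀ {z} → InInterval n v c z → covered T z ≡ false → ¬ Extended
    uncovered⇒not-extended z∈ cov ext with () ← trans (sym (Tv-covers-extended ext (widen z∈))) cov

  Tv-covers : ∀ {z} → InInterval n v c z → covered T z ≡ true
  Tv-covers {z} z∈ with covered T z in cov
  ... | true  = refl
  ... | false with () ← trans (sym (proj₂ (proj₂ (proj₂ isTv) (uncovered⇒not-extended z∈ cov) z) z∈)) cov

divℕ-* : ∀ {x y} → 0 < y → y ∣ x → divℕ x y * y ≡ x
divℕ-* {y = suc y} _ (divides t refl) = cong (_* suc y) (m*n/n≡m t (suc y))

module Equilibrium (k M : ℕ) (k≥2 : 2 ≤ k) (2^k<n : 2 ^ k < suc (suc M)) (d≥2 : 2 ≤ dOf (suc (suc M)) k) where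

  n N c d w : ℕ
  n = suc (suc M)
  N = suc M
  c = cOf k
  d = dOf n k
  w = wOf n k

  open Multiples d (ℕP.≤-trans (s≤s z≤n) d≥2)

  y : ℕ → ℚ
  y = yStar n k

  β : ℚ
  β = fracℕ c N

  2^k≡c+2 : 2 ^ k ≡ c + 2
  2^k≡c+2 = sym (ℕP.m∸n+n≡m (ℕP.^-monoʳ-≤ 2 (ℕP.≤-trans (s≤s z≤n) k≥2)))

  c<M : c < M
  c<M = ℕP.≤-pred (ℕP.≤-pred (subst (_< n) (trans 2^k≡c+2 (ℕP.+-comm c 2)) 2^k<n))

  c<N : c < N
  c<N = ℕP.m<n⇒m<1+n c<M

  N>0 : 0 < N
  N>0 = s≤s z≤n

  d∣c : d ∣ c
  d∣c = gcd[m,n]∣m c N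

  d∣N : d ∣ N
  d∣N = gcd[m,n]∣n c N

  q : ℕ
  q = _∣_.quotient d∣c

  c≡q*d : c ≡ q * d
  c≡q*d = _∣_.equality d∣c

  N≡w*d : N ≡ w * d
  N≡w*d = sym (divℕ-* (ℕP.≤-trans (s≤s z≤n) d≥2) d∣N)

  w>0 : 0 < w
  w>0 with w | N≡w*d
  ... | suc _ | _ = s≤s z≤n

  wD>0 : 0 < w * D
  wD>0 = ℕP.*-mono-≤ w>0 (ℕP.∸-monoˡ-≤ 1 d≥2)

  Dq*N≡c*wD : D * q * N ≡ c * (w * D)
  Dq*N≡c*wD = begin
    D * q * N            ≡⟨ cong (D * q *_) N≡w*d ⟩
    D * q * (w * d)      ≡⟨ shuffle D q w d ⟩
    q * d * (w * D)      ≡⟨ cong (_* (w * D)) c≡q*d ⟨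
    c * (w * D)          ∎
    where
    open ≡-Reasoning
    shuffle : ∀ D q w d → D * q * (w * d) ≡ q * d * (w * D)
    shuffle = ℕSolver.solve-∀

  hit : StratG n → ℕ → Bool
  hit T = Runs.hit (covered T)

  α : ℚ
  α = fracℕ 1 (w * D)

  y-indicator : ∀ v → y v ≡ (if nonMultiple v then α else 0ℚ)
  y-indicator v with does (d ∣? v)
  ... | true  = refl
  ... | false = refl

  hider-distribution : IsHiderDist n y
  hider-distribution = y-nonNeg , (begin
    sumℚ (map y (upTo n))                                          ≡⟨ sumℚ-cong y-indicator (upTo n) ⟩
    sumℚ (map (λ v → if nonMultiple v then α else 0ℚ) (upTo n))    ≡⟨ sumℚ-indicator nonMultiple wD>0 (upTo n) ⟩
    fracℕ (count nonMultiple (upTo n)) (w * D)                     ≡⟨ cong (λ m → fracℕ m (w * D)) count≡wD ⟩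
    fracℕ (w * D) (w * D)                                          ≡⟨ fracℕ-self wD>0 ⟩
    1ℚ                                                             ∎)
    where
    open ≡-Reasoning
    y-nonNeg : ∀ v → v < n → 0ℚ ℚ.≤ y v
    y-nonNeg v _ rewrite y-indicator v with nonMultiple v
    ... | true  = fracℕ-nonNeg 1 (w * D)
    ... | false = ℚP.≤-refl
    count≡wD : count nonMultiple (upTo n) ≡ w * D
    count≡wD = trans (count-applyUpTo nonMultiple id n)
      (trans (cong (λ m → ∑[ v < suc m ] 𝟙 (nonMultiple v)) N≡w*d) (∑-nonMultiple w))

  yC-as-count : ∀ T → yC n y T ≡ fracℕ (∑[ v < n ] 𝟙 (hit T v)) (w * D)
  yC-as-count T = begin
    sumℚ (map (λ v → if covered T v then y v else 0ℚ) (upTo n))   ≡⟨ sumℚ-cong hit-indicator (upTo n) ⟩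
    sumℚ (map (λ v → if hit T v then α else 0ℚ) (upTo n))         ≡⟨ sumℚ-indicator (hit T) wD>0 (upTo n) ⟩
    fracℕ (count (hit T) (upTo n)) (w * D)
      ≡⟨ cong (λ m → fracℕ m (w * D)) (count-applyUpTo (hit T) id n) ⟩
    fracℕ (∑[ v < n ] 𝟙 (hit T v)) (w * D)                        ∎
    where
    open ≡-Reasoning
    hit-indicator : ∀ v → (if covered T v then y v else 0ℚ) ≡ (if hit T v then α else 0ℚ)
    hit-indicator v with covered T v
    ... | true  = y-indicator v
    ... | false = refl

  hider-bound : ∀ (T : StratG n) → height T ≤ k → yC n y T ≤ℚ β
  hider-bound T hT = subst (_≤ℚ β) (sym (yC-as-count T))
    (fracℕ-≤ hits c wD>0 N>0 (ℕP.≤-trans (ℕP.*-monoˡ-≤ N hits≤Dq) (ℕP.≤-reflexive Dq*N≡c*wD)))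
    where
    open Runs (covered T) using (starts; hits≤)
    hits : ℕ
    hits = ∑[ v < n ] 𝟙 (hit T v)
    starts≤ : ∑[ v < n ] 𝟙 (starts v) ≤ q * d + 2
    starts≤ = begin
      ∑[ v < n ] 𝟙 (starts v)    ≤⟨ ∑leftEnd≤leaves T N refl ⟩
      leaves T                   ≤⟨ leaves≤2^height T ⟩
      2 ^ height T               ≤⟨ ℕP.^-monoʳ-≤ 2 hT ⟩
      2 ^ k                      ≡⟨ 2^k≡c+2 ⟩
      c + 2                      ≡⟨ cong (_+ 2) c≡q*d ⟩
      q * d + 2                  ∎
      where open ℕP.≤-Reasoning
    hits≤Dq : hits ≤ D * q
    hits≤Dq = subst (λ m → ∑[ v < suc m ] 𝟙 (hit T v) ≤ D * q) (sym N≡w*d)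
      (hits≤ w q (subst (λ m → ∑[ v < suc m ] 𝟙 (starts v) ≤ q * d + 2) N≡w*d starts≤))

  2^[k]-1≡1+c : 2^[ k ]-1 ≡ suc c
  2^[k]-1≡1+c = ℕP.suc-injective (trans (1+2^[ k ]-1) (trans 2^k≡c+2 (ℕP.+-comm c 2)))

  prefix<N : 0 + 2^[ k ]-1 < N
  prefix<N = subst (_< N) (sym 2^[k]-1≡1+c) (s≤s c<M)

  T* : StratG n
  T* = coverPrefix k 0 N prefix<N

  hits-T* : ∑[ v < n ] 𝟙 (hit T* v) ≡ q * D
  hits-T* = begin
    ∑[ v < n ] 𝟙 (hit T* v)                                        ≡⟨ cong (λ m → ∑[ v < m ] 𝟙 (hit T* v)) n≡1+c+r ⟩
    ∑[ v < suc c + r ] 𝟙 (hit T* v)                                ≡⟨ ∑-split (suc c) r (λ v → 𝟙 (hit T* v)) ⟩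
    ∑[ v < suc c ] 𝟙 (hit T* v) + ∑[ i < r ] 𝟙 (hit T* (suc c + i))
      ≡⟨ cong₂ _+_ (∑-cong (suc c) inside) (∑-zero r outside) ⟩
    ∑[ v < suc c ] 𝟙 (nonMultiple v) + 0                           ≡⟨ ℕP.+-identityʳ _ ⟩
    ∑[ v < suc c ] 𝟙 (nonMultiple v)
      ≡⟨ cong (λ m → ∑[ v < suc m ] 𝟙 (nonMultiple v)) c≡q*d ⟩
    ∑[ v < suc (q * d) ] 𝟙 (nonMultiple v)                         ≡⟨ ∑-nonMultiple q ⟩
    q * D                                                          ∎
    where
    open ≡-Reasoning
    r = N ∸ c
    n≡1+c+r : n ≡ suc c + r
    n≡1+c+r = cong suc (sym (ℕP.m+[n∸m]≡n (ℕP.<⇒≤ c<N)))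
    inside : ∀ v → v < suc c → 𝟙 (hit T* v) ≡ 𝟙 (nonMultiple v)
    inside v v≤c rewrite coverPrefix-covered k 0 N prefix<N z≤n (subst (v <_) (sym 2^[k]-1≡1+c) v≤c) = refl
    outside : ∀ i → i < r → 𝟙 (hit T* (suc c + i)) ≡ 0
    outside i _ rewrite coverPrefix-uncovered k 0 N prefix<N {suc c + i}
                          (subst (_≤ suc c + i) (sym 2^[k]-1≡1+c) (ℕP.m≤m+n (suc c) i)) = refl

  hider-attained : Σ (StratG n) (λ T → (height T ≤ k) × (yC n y T ≡ β))
  hider-attained = T* , coverPrefix-height k 0 N prefix<N , (begin
    yC n y T*                             ≡⟨ yC-as-count T* ⟩
    fracℕ (∑[ v < n ] 𝟙 (hit T* v)) (w * D) ≡⟨ cong (λ m → fracℕ m (w * D)) hits-T* ⟩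
    fracℕ (q * D) (w * D)
      ≡⟨ fracℕ-≡ (q * D) c wD>0 N>0 (trans (cong (_* N) (ℕP.*-comm q D)) Dq*N≡c*wD) ⟩
    β                                     ∎)
    where open ≡-Reasoning

  seeker-bound : ∀ xs → IsSeekerDist n k xs → payoff n xs y ≤ℚ β
  seeker-bound xs (bounded , total) = begin
    sumℚ (map (λ p → proj₂ p ℚ.* yC n y (proj₁ p)) xs)   ≤⟨ sumℚ-mono (All.map each bounded) ⟩
    sumℚ (map (λ p → proj₂ p ℚ.* β) xs)                  ≡⟨ sumℚ-*ʳ β proj₂ xs ⟨
    sumℚ (map proj₂ xs) ℚ.* β                            ≡⟨ cong (ℚ._* β) total ⟩
    1ℚ ℚ.* β                                             ≡⟨ ℚP.*-identityˡ β ⟩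
    β                                                    ∎
    where
    open ℚP.≤-Reasoning
    each : ∀ {p : StratG n × ℚ} → (height (proj₁ p) ≤ k) × (0ℚ ℚ.≤ proj₂ p) →
           proj₂ p ℚ.* yC n y (proj₁ p) ≤ℚ proj₂ p ℚ.* β
    each {_ , p} (hT , p≥0) = ℚP.*-monoˡ-≤-nonNeg p {{ℚ.nonNegative p≥0}} (hider-bound _ hT)

  open CircularWindows N c

  1<N : 1 < N
  1<N = s≤s (ℕP.≤-trans (s≤s z≤n) c<M)

  orbit-returns : orbit w ≡ 1
  orbit-returns = begin
    (1 + w * c) % N     ≡⟨ cong (λ m → (1 + m) % N) wc≡qN ⟩
    (1 + q * N) % N     ≡⟨ [m+kn]%n≡m%n 1 q N ⟩
    1 % N               ≡⟨ m<n⇒m%n≡m 1<N ⟩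
    1                   ∎
    where
    open ≡-Reasoning
    shuffle : ∀ w q d → w * (q * d) ≡ q * (w * d)
    shuffle = ℕSolver.solve-∀
    wc≡qN : w * c ≡ q * N
    wc≡qN = trans (cong (w *_) c≡q*d) (trans (shuffle w q d) (cong (q *_) (sym N≡w*d)))

  orbit≢0 : ∀ j → orbit j ≢ 0
  orbit≢0 j orbit≡0 = ℕP.<⇒≢ d≥2 (sym (∣1⇒≡1 d∣1))
    where
    d∣1+jc : d ∣ j * c + 1
    d∣1+jc = subst (d ∣_) (ℕP.+-comm 1 (j * c)) (∣-trans d∣N (m%n≡0⇒n∣m (1 + j * c) N orbit≡0))
    d∣1 : d ∣ 1
    d∣1 = ∣m+n∣m⇒∣n d∣1+jc (∣-trans d∣c (n∣m*n j))

  cycle-closes : walkEnd n (step 1) ≡ 1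
  cycle-closes = subst (λ v → walkEnd n v ≡ 1) (cong (λ m → (1 + m) % N) (ℕP.*-identityˡ c))
    (walkEnd-orbit w orbit-returns orbit≢0 n 1 w>0 w≤1+n)
    where
    w≤N : w ≤ N
    w≤N = subst (w ≤_) (sym N≡w*d) (ℕP.m≤m*n w d {{ℕ.>-nonZero (ℕP.≤-trans (s≤s z≤n) d≥2)}})
    w≤1+n : w ≤ 1 + n
    w≤1+n = ℕP.≤-trans w≤N (ℕP.≤-trans (ℕP.n≤1+n N) (ℕP.n≤1+n n))

  module Greedy (Tf : ℕ → StratG n) (Tf-spec : ∀ v → v < n → v ≢ 1 → IsTv n k c v (Tf v)) where

    cycle : List ℕ
    cycle = walk n (step 1)

    greedyLoop≡ : ∀ f v → greedyLoop n c Tf f v ≡ map Tf (walk f v)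
    greedyLoop≡ zero    v = refl
    greedyLoop≡ (suc f) v with v ℕ.≤ᵇ 1
    ... | true  = refl
    ... | false = cong (Tf v ∷_) (greedyLoop≡ f (step v))

    X : List (StratG n)
    X = greedySet n c Tf

    X≡ : X ≡ Tf 0 ∷ map Tf cycle
    X≡ = cong (Tf 0 ∷_) (trans (cong (greedyLoop n c Tf n) (sym (m<n⇒m%n≡m (s≤s c<M)))) (greedyLoop≡ n (step 1)))

    cycle-bounds : All (λ s → 2 ≤ s × s < N) cycle
    cycle-bounds = walk-bounds n (m%n<n (1 + c) N)

    Tf-covers : ∀ {v z} → v < n → v ≢ 1 → InInterval n v c z → covered (Tf v) z ≡ true
    Tf-covers {v} v<n v≢1 = Tv-covers {n} {k} {c} {v} {Tf v} (Tf-spec v v<n v≢1)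

    Tf-covers-extended : ∀ {v z} → v < n → v ≢ 1 → InInterval n v (suc c) 0 ⊎ InInterval n v (suc c) N →
      InInterval n v (suc c) z → covered (Tf v) z ≡ true
    Tf-covers-extended {v} v<n v≢1 ext = Tv-covers-extended {n} {k} {c} {v} {Tf v} (Tf-spec v v<n v≢1) ext

    T0-covers : ∀ {z} → z ≤ c → covered (Tf 0) z ≡ true
    T0-covers {z} z≤c = Tf-covers-extended (s≤s z≤n) (λ ()) (inj₁ (0 , s≤s z≤n , refl))
      (z , s≤s z≤c , sym (m<n⇒m%n≡m (ℕP.≤-trans (s≤s z≤c) (ℕP.≤-trans c<N (ℕP.n≤1+n N)))))

    inWindow-1⇒≤c : ∀ {z} → inWindow z 1 ≡ true → z ≤ c
    inWindow-1⇒≤c {zero}  _   = z≤n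
    inWindow-1⇒≤c {suc z} win = <ᵇ-true⇒< {z} win

    not-inWindow-0-1 : inWindow 0 1 ≡ false
    not-inWindow-0-1 = ≥⇒<ᵇ-false (ℕP.<⇒≤ c<M)

    -- A window wrapping around past N contains N, so T_s is then the extended strategy.
    window-covers : ∀ {s z} → 2 ≤ s → s < N → z < N → inWindow z s ≡ true → covered (Tf s) z ≡ true
    window-covers {suc zero} (s≤s ())
    window-covers {s@(suc (suc _))} {z} _ s<N z<N win with s ℕ.≤ᵇ z in s≤?z
    ... | true  = Tf-covers (ℕP.m<n⇒m<1+n s<N) (λ ())
      (z ∸ s , <ᵇ-true⇒< {z ∸ s} win , sym (offset-mod (≤ᵇ-true⇒≤ {s} {z} s≤?z) (ℕP.m<n⇒m<1+n z<N)))
    ... | false = Tf-covers-extended (ℕP.m<n⇒m<1+n s<N) (λ ())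
      (inj₂ (N ∸ s , N∸s<1+c , sym (offset-mod (ℕP.<⇒≤ s<N) (ℕP.n<1+n N))))
      (suc ((z + N) ∸ s) , s≤s gap<c , sym (begin
        (s + suc ((z + N) ∸ s)) % n     ≡⟨ cong (_% n) (ℕP.+-suc s _) ⟩
        suc (s + ((z + N) ∸ s)) % n     ≡⟨ cong (λ m → suc m % n) (ℕP.m+[n∸m]≡n s≤z+N) ⟩
        suc (z + N) % n                 ≡⟨ cong (_% n) (ℕP.+-suc z N) ⟨
        (z + n) % n                     ≡⟨ [m+n]%n≡m%n z n ⟩
        z % n                           ≡⟨ m<n⇒m%n≡m (ℕP.m<n⇒m<1+n z<N) ⟩
        z                               ∎))
      where
      open ≡-Reasoning
      gap<c : (z + N) ∸ s < c
      gap<c = <ᵇ-true⇒< {(z + N) ∸ s} win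
      s≤z+N : s ≤ z + N
      s≤z+N = ℕP.≤-trans (ℕP.<⇒≤ s<N) (ℕP.m≤n+m N z)
      N∸s<1+c : N ∸ s < suc c
      N∸s<1+c = s≤s (ℕP.≤-trans (ℕP.∸-monoˡ-≤ s (ℕP.m≤n+m N z)) (ℕP.<⇒≤ gap<c))

    window-covers-N : ∀ {s} → 2 ≤ s → s < N → inWindow 0 s ≡ true → covered (Tf s) N ≡ true
    window-covers-N {suc zero} (s≤s ())
    window-covers-N {s@(suc (suc _))} _ s<N win = Tf-covers (ℕP.m<n⇒m<1+n s<N) (λ ())
      (N ∸ s , <ᵇ-true⇒< {N ∸ s} win , sym (offset-mod (ℕP.<⇒≤ s<N) (ℕP.n<1+n N)))

    #X : ℕ
    #X = length X

    -- T_0 stands in for the cycle point 1: its window {0, …, c} contains {1, …, c}.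
    coverage-via : ∀ {z z′} → z′ < N →
      (inWindow z′ 1 ≡ true → covered (Tf 0) z ≡ true) →
      (∀ {s} → 2 ≤ s → s < N → inWindow z′ s ≡ true → covered (Tf s) z ≡ true) →
      c * #X ≤ count (λ S → covered S z) X * N
    coverage-via {z} {z′} z′<N head tail =
      subst (λ Y → c * length Y ≤ count (λ S → covered S z) Y * N) (sym X≡) (begin
      c * suc (length (map Tf cycle))                       ≡⟨ cong (λ m → c * suc m) (LP.length-map Tf cycle) ⟩
      c * suc (length cycle)                                ≡⟨ ℕP.*-comm c _ ⟩
      suc (length cycle) * c                                ≡⟨ cycle-count c<N 1<N z′<N n cycle-closes ⟩
      count (inWindow z′) (1 ∷ cycle) * N                   ≤⟨ ℕP.*-monoˡ-≤ N (ℕP.+-mono-≤ (𝟙-mono head)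
                                                                 (count-map-mono (inWindow z′) (λ S → covered S z) Tf
                                                                   (All.map (λ (s≥2 , s<N) → tail s≥2 s<N) cycle-bounds))) ⟩
      count (λ S → covered S z) (Tf 0 ∷ map Tf cycle) * N   ∎)
      where open ℕP.≤-Reasoning

    -- Vertex N is the point 0 of the cycle ℤ/N.
    coverage : ∀ {z} → z ≤ N → c * #X ≤ count (λ S → covered S z) X * N
    coverage {z} z≤N with z ℕ.<? N
    ... | yes z<N = coverage-via z<N (λ win → T0-covers (inWindow-1⇒≤c win))
                                     (λ s≥2 s<N → window-covers s≥2 s<N z<N)
    ... | no  z≮N rewrite ℕP.≤-antisym z≤N (ℕP.≮⇒≥ z≮N) = coverage-via N>0
          (subst (λ b → b ≡ true → covered (Tf 0) N ≡ true) (sym not-inWindow-0-1) (λ ())) window-covers-N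

    x : SeekerMixed n
    x = greedyX n c Tf

    #X>0 : 0 < #X
    #X>0 = s≤s z≤n

    payoff-greedy : ∀ y′ →
      payoff n x y′ ≡ sumℚ (map (λ z → fracℕ (count (λ S → covered S z) X) #X ℚ.* y′ z) (upTo n))
    payoff-greedy y′ = begin
      sumℚ (map (λ p → proj₂ p ℚ.* yC n y′ (proj₁ p)) (map (λ S → S , a) X))
        ≡⟨ cong sumℚ (LP.map-∘ {g = λ p → proj₂ p ℚ.* yC n y′ (proj₁ p)} {f = λ S → S , a} X) ⟨
      sumℚ (map (λ S → a ℚ.* yC n y′ S) X)
        ≡⟨ sumℚ-cong (λ S → sumℚ-*ˡ a (indicator S) (upTo n)) X ⟩
      sumℚ (map (λ S → sumℚ (map (λ z → a ℚ.* indicator S z) (upTo n))) X)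
        ≡⟨ sumℚ-swap (λ S z → a ℚ.* indicator S z) X (upTo n) ⟩
      sumℚ (map (λ z → sumℚ (map (λ S → a ℚ.* indicator S z) X)) (upTo n))
        ≡⟨ sumℚ-cong (λ z → sumℚ-scaled-indicator (λ S → covered S z) #X>0 (y′ z) X) (upTo n) ⟩
      sumℚ (map (λ z → fracℕ (count (λ S → covered S z) X) #X ℚ.* y′ z) (upTo n)) ∎
      where
      open ≡-Reasoning
      a : ℚ
      a = fracℕ 1 #X
      indicator : StratG n → ℕ → ℚ
      indicator S z = if covered S z then y′ z else 0ℚ

    greedy-guarantee : ∀ y′ → IsHiderDist n y′ → β ≤ℚ payoff n x y′
    greedy-guarantee y′ (y′≥0 , y′-total) = begin
      β                                         ≡⟨ ℚP.*-identityʳ β ⟨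
      β ℚ.* 1ℚ                                  ≡⟨ cong (β ℚ.*_) y′-total ⟨
      β ℚ.* sumℚ (map y′ (upTo n))              ≡⟨ sumℚ-*ˡ β y′ (upTo n) ⟩
      sumℚ (map (λ z → β ℚ.* y′ z) (upTo n))    ≤⟨ sumℚ-mono (applyUpTo⁺₁ id n each) ⟩
      sumℚ (map (λ z → fracℕ (count (λ S → covered S z) X) #X ℚ.* y′ z) (upTo n))
                                                ≡⟨ payoff-greedy y′ ⟨
      payoff n x y′                             ∎
      where
      open ℚP.≤-Reasoning
      each : ∀ {z} → z < n → β ℚ.* y′ z ≤ℚ fracℕ (count (λ S → covered S z) X) #X ℚ.* y′ z
      each {z} z<n = ℚP.*-monoʳ-≤-nonNeg (y′ z) {{ℚ.nonNegative (y′≥0 z z<n)}}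
        (fracℕ-≤ c (count (λ S → covered S z) X) N>0 #X>0 (coverage (ℕP.≤-pred z<n)))

    seeker-dist : IsSeekerDist n k x
    seeker-dist = map⁺ {f = λ S → S , fracℕ 1 #X} (All.map (λ h → h , fracℕ-nonNeg 1 #X) heights)
                , (begin
      sumℚ (map proj₂ (map (λ S → S , fracℕ 1 #X) X))
        ≡⟨ cong sumℚ (LP.map-∘ {g = proj₂} {f = λ S → S , fracℕ 1 #X} X) ⟨
      sumℚ (map (λ _ → fracℕ 1 #X) X)                  ≡⟨ sumℚ-indicator (λ _ → true) #X>0 X ⟩
      fracℕ (count (λ _ → true) X) #X                  ≡⟨ cong (λ m → fracℕ m #X) (count-true X) ⟩
      fracℕ #X #X                                      ≡⟨ fracℕ-self #X>0 ⟩
      1ℚ                                               ∎)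
      where
      open ≡-Reasoning
      heights : All (λ S → height S ≤ k) X
      heights = subst (All (λ S → height S ≤ k)) (sym X≡) (proj₁ (Tf-spec 0 (s≤s z≤n) (λ ()))
        ∷ map⁺ (All.map (λ (s≥2 , s<N) → proj₁ (Tf-spec _ (ℕP.m<n⇒m<1+n s<N) (λ s≡1 → ℕP.<⇒≢ s≥2 (sym s≡1))))
                            cycle-bounds))

    nash : IsNash n k x y
    nash = seeker-dist , hider-distribution
         , (λ x′ x′-dist → ℚP.≤-trans (seeker-bound x′ x′-dist) (greedy-guarantee y hider-distribution))
         , (λ y′ y′-dist → ℚP.≤-trans (seeker-bound x seeker-dist) (greedy-guarantee y′ y′-dist))

theorem3p1 : (k n : ℕ) → 2 ≤ k → 2 ^ k < n → 1 < dOf n k →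
    IsHiderDist n (yStar n k)
    × ((∀ (T : StratG n) → height T ≤ k → yC n (yStar n k) T ≤ℚ fracℕ (cOf k) (n ∸ 1))
      × Σ (StratG n) (λ T → (height T ≤ k) × (yC n (yStar n k) T ≡ fracℕ (cOf k) (n ∸ 1))))
    × ((Tf : ℕ → StratG n) →
       (∀ v → v < n → v ≢ 1 → IsTv n k (cOf k) v (Tf v)) →
       IsNash n k (greedyX n (cOf k) Tf) (yStar n k))
theorem3p1 k zero          _   ()  _
theorem3p1 k (suc zero)    _   (s≤s 2^k≤0) _ = ⊥-elim (ℕP.<⇒≱ (ℕP.m^n>0 2 k) 2^k≤0)
theorem3p1 k (suc (suc M)) k≥2 2^k<n d≥2 = hider-distribution , (hider-bound , hider-attained) , Greedy.nash
  where open Equilibrium k M k≥2 2^k<n d≥2
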